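{- Let $r,s,t$ be real numbers and $a,b,c$ integers, let $\{V_n\}_{n\ge0}$ be defined by $V_0=a$, $V_1=b$, $V_2=c$ and $V_n=rV_{n-1}+sV_{n-2}+tV_{n-3}$ for $n\ge3$, and let $Q_{v,n}=V_n+V_{n+1}i+V_{n+2}j+V_{n+3}k$ for $n\ge0$ (quaternions with $i^2=j^2=k^2=ijk=-1$). Then for every $n\ge0$, $$Q_{v,3n}=\sum_{l=0}^{n}\sum_{m=0}^{l}\binom{n}{l}\binom{l}{m}r^{m}s^{l-m}t^{n-l}Q_{v,l+m}.$$ -}

module Defs where

open import Level using (_⊔_)
open import Data.Nat using (ℕ; zero; suc; _∸_)
open import Data.Nat.Combinatorics using (_C_)
open import Data.Integer using (ℤ; +_; -[1+_])
open import Data.Product using (_×_)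
open import Algebra.Bundles using (CommutativeRing; Semiring)
import Algebra.Definitions.RawSemiring as RS

-- The real numbers are not available in agda-stdlib; the paper's statement
-- is formalised over an arbitrary commutative ring R (ℝ being one instance).
module Quat {c ℓ} (R : CommutativeRing c ℓ) where
  open CommutativeRing R hiding (zero)
  open RS (Semiring.rawSemiring semiring) using (_^_) renaming (_×_ to _·_)

  fromℤ : ℤ → Carrier
  fromℤ (+ n)      = n · 1#
  fromℤ -[1+ n ]   = - (suc n · 1#)

  record Quaternion : Set c where
    constructor quat
    field
      re  : Carrier
      imi : Carrier
      imj : Carrier
      imk : Carrier
  open Quaternion public

  _≈Q_ : Quaternion → Quaternion → Set ℓ
  p ≈Q q = (re p ≈ re q) × (imi p ≈ imi q) × (imj p ≈ imj q) × (imk p ≈ imk q)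

  0Q : Quaternion
  0Q = quat 0# 0# 0# 0#

  _+Q_ : Quaternion → Quaternion → Quaternion
  quat a b c d +Q quat a' b' c' d' = quat (a + a') (b + b') (c + c') (d + d')

  _•_ : Carrier → Quaternion → Quaternion
  x • quat a b c d = quat (x * a) (x * b) (x * c) (x * d)

  -- Hamilton product, with i² = j² = k² = ijk = -1
  _*Q_ : Quaternion → Quaternion → Quaternion
  quat a₁ b₁ c₁ d₁ *Q quat a₂ b₂ c₂ d₂ =
    quat (a₁ * a₂ - b₁ * b₂ - c₁ * c₂ - d₁ * d₂)
         (a₁ * b₂ + b₁ * a₂ + c₁ * d₂ - d₁ * c₂)
         (a₁ * c₂ - b₁ * d₂ + c₁ * a₂ + d₁ * b₂)
         (a₁ * d₂ + b₁ * c₂ - c₁ * b₂ + d₁ * a₂)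

  -- ΣQ[ n ] f = f 0 +Q f 1 +Q … +Q f n   (inclusive upper bound)
  ΣQ : ℕ → (ℕ → Quaternion) → Quaternion
  ΣQ zero    f = f zero
  ΣQ (suc n) f = ΣQ n f +Q f (suc n)

  module Sequence (r s t : Carrier) (a b c : ℤ) where
    V : ℕ → Carrier
    V zero                   = fromℤ a
    V (suc zero)             = fromℤ b
    V (suc (suc zero))       = fromℤ c
    V (suc (suc (suc n)))    = r * V (suc (suc n)) + s * V (suc n) + t * V n

    QV : ℕ → Quaternion
    QV n = quat (V n) (V (suc n)) (V (suc (suc n))) (V (suc (suc (suc n))))

    coeff : ℕ → ℕ → ℕ → Carrier
    coeff n l m = (((n C l) · 1#) * ((l C m) · 1#)) * ((r ^ m) * (s ^ (l ∸ m)) * (t ^ (n ∸ l)))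

module Submission where

open import Defs
open import Level using (Level)
open import Data.Nat using (ℕ; _+_; _*_)
open import Data.Integer using (ℤ)
open import Algebra.Bundles using (CommutativeRing)

open import Data.Nat using (zero; suc; _∸_; _≤_; z≤n)
open import Data.Nat.Properties using (m≤n⇒m≤1+n; ≤-refl; n<1+n; +-∸-assoc; +-suc; *-suc)
open import Data.Nat.Combinatorics using (_C_; nCk+nC[k+1]≡[n+1]C[k+1]; k>n⇒nCk≡0)
open import Data.Product using (_,_)
open import Function using (_∘_)
open import Relation.Binary.PropositionalEquality using (cong)
open import Algebra.Bundles using (Semiring)
import Algebra.Definitions.RawSemiring as RawSemiringDefinitions
import Algebra.Properties.Semiring.Mult as SemiringMult
import Relation.Binary.Reasoning.Setoid as SetoidReasoning
import Algebra.Solver.Ring.NaturalCoefficients.Default as NaturalSolver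

-- Write E for the shift of sequences, (E f)(k) = f(k+1).  A
-- sequence f obeying f(k+3) = r f(k+2) + s f(k+1) + t f(k) satisfies
-- E³ f = (r E² + s E + t) f, so f(3n) = ((t + (r E² + s E))ⁿ f)(0); expanding
-- twice by the binomial theorem gives
--   f(3n) = Σ_{l ≤ n} C(n,l) t^(n-l) Σ_{m ≤ l} C(l,m) r^m s^(l-m) f(l+m).
-- We avoid operator algebra and prove this by induction on n, the engine
-- being Pascal's rule for the binomial transform
--   B x y n h = Σ_{m ≤ n} C(n,m) x^m y^(n-m) h(m),
--   B x y (n+1) h = y · B x y n h + x · B x y n (h ∘ suc).  The theorem for quaternions
-- follows coordinatewise, since each coordinate of Q_{v,k} is a shift of V
-- and hence again a solution of the recurrence.

-- Finite sums Σ n f = f 0 + f 1 + … + f n, with the same inclusive upper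
-- bound as the quaternion sum ΣQ of Defs.
module FiniteSums {c ℓ} (R : CommutativeRing c ℓ) where
  open CommutativeRing R renaming (_+_ to _+ᴿ_; _*_ to _*ᴿ_) hiding (zero)
  open SetoidReasoning setoid
  open NaturalSolver commutativeSemiring using (solve; _:+_; _:=_)

  Σ : ℕ → (ℕ → Carrier) → Carrier
  Σ zero    f = f zero
  Σ (suc n) f = Σ n f +ᴿ f (suc n)

  Σ-cong≤ : ∀ n {f g : ℕ → Carrier} → (∀ m → m ≤ n → f m ≈ g m) → Σ n f ≈ Σ n g
  Σ-cong≤ zero    f≈g = f≈g 0 z≤n
  Σ-cong≤ (suc n) f≈g =
    +-cong (Σ-cong≤ n (λ m m≤n → f≈g m (m≤n⇒m≤1+n m≤n))) (f≈g (suc n) ≤-refl)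

  Σ-cong : ∀ n {f g : ℕ → Carrier} → (∀ m → f m ≈ g m) → Σ n f ≈ Σ n g
  Σ-cong n f≈g = Σ-cong≤ n (λ m _ → f≈g m)

  Σ-+ : ∀ n (f g : ℕ → Carrier) → Σ n (λ m → f m +ᴿ g m) ≈ Σ n f +ᴿ Σ n g
  Σ-+ zero    f g = refl
  Σ-+ (suc n) f g = begin
    Σ n (λ m → f m +ᴿ g m) +ᴿ (f (suc n) +ᴿ g (suc n))
      ≈⟨ +-congʳ (Σ-+ n f g) ⟩
    (Σ n f +ᴿ Σ n g) +ᴿ (f (suc n) +ᴿ g (suc n))
      ≈⟨ solve 4 (λ a b x y → (a :+ b) :+ (x :+ y) := (a :+ x) :+ (b :+ y)) refl
           (Σ n f) (Σ n g) (f (suc n)) (g (suc n)) ⟩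
    (Σ n f +ᴿ f (suc n)) +ᴿ (Σ n g +ᴿ g (suc n)) ∎

  Σ-*ˡ : ∀ n a (f : ℕ → Carrier) → Σ n (λ m → a *ᴿ f m) ≈ a *ᴿ Σ n f
  Σ-*ˡ zero    a f = refl
  Σ-*ˡ (suc n) a f = trans (+-congʳ (Σ-*ˡ n a f)) (sym (distribˡ a (Σ n f) (f (suc n))))

  Σ-head : ∀ n (f : ℕ → Carrier) → Σ (suc n) f ≈ f 0 +ᴿ Σ n (f ∘ suc)
  Σ-head zero    f = refl
  Σ-head (suc n) f = trans (+-congʳ (Σ-head n f)) (+-assoc _ _ _)

module BinomialTransform {c ℓ} (R : CommutativeRing c ℓ) where
  open CommutativeRing R renaming (_+_ to _+ᴿ_; _*_ to _*ᴿ_) hiding (zero)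
  open RawSemiringDefinitions (Semiring.rawSemiring semiring) using (_^_) renaming (_×_ to _·_)
  open SemiringMult semiring using (×-homo-+)
  open SetoidReasoning setoid
  open NaturalSolver commutativeSemiring using (solve; _:+_; _:*_; _:=_)
  open FiniteSums R

  term : Carrier → Carrier → ℕ → ℕ → Carrier
  term x y n m = (n C m) · 1# *ᴿ (x ^ m *ᴿ y ^ (n ∸ m))

  -- the same with one more factor y; it is y · term below m = n+1 and 0 at m = n+1
  term⁺ : Carrier → Carrier → ℕ → ℕ → Carrier
  term⁺ x y n m = (n C m) · 1# *ᴿ (x ^ m *ᴿ y ^ (suc n ∸ m))

  B : Carrier → Carrier → ℕ → (ℕ → Carrier) → Carrier
  B x y n h = Σ n (λ m → term x y n m *ᴿ h m)

  B-zero : ∀ x y (h : ℕ → Carrier) → B x y 0 h ≈ h 0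
  B-zero x y h = trans (*-congʳ unit) (*-identityˡ (h 0))
    where
    unit : (1# +ᴿ 0#) *ᴿ (1# *ᴿ 1#) ≈ 1#
    unit = trans (*-congʳ (+-identityʳ 1#)) (trans (*-identityˡ _) (*-identityˡ 1#))

  B-cong : ∀ x y n {h g : ℕ → Carrier} → (∀ m → h m ≈ g m) → B x y n h ≈ B x y n g
  B-cong x y n h≈g = Σ-cong n (λ m → *-congˡ (h≈g m))

  B-linear : ∀ x y n a b (h g : ℕ → Carrier) →
    B x y n (λ m → a *ᴿ h m +ᴿ b *ᴿ g m) ≈ a *ᴿ B x y n h +ᴿ b *ᴿ B x y n g
  B-linear x y n a b h g = begin
    B x y n (λ m → a *ᴿ h m +ᴿ b *ᴿ g m)
      ≈⟨ Σ-cong n (λ m → solve 5 (λ w a b h g → w :* (a :* h :+ b :* g) := a :* (w :* h) :+ b :* (w :* g))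
                                  refl (term x y n m) a b (h m) (g m)) ⟩
    Σ n (λ m → a *ᴿ (term x y n m *ᴿ h m) +ᴿ b *ᴿ (term x y n m *ᴿ g m))
      ≈⟨ Σ-+ n _ _ ⟩
    Σ n (λ m → a *ᴿ (term x y n m *ᴿ h m)) +ᴿ Σ n (λ m → b *ᴿ (term x y n m *ᴿ g m))
      ≈⟨ +-cong (Σ-*ˡ n a _) (Σ-*ˡ n b _) ⟩
    a *ᴿ B x y n h +ᴿ b *ᴿ B x y n g ∎

  term-pascal : ∀ x y n k → term x y (suc n) (suc k) ≈ x *ᴿ term x y n k +ᴿ term⁺ x y n (suc k)
  term-pascal x y n k = begin
    (suc n C suc k) · 1# *ᴿ P
      ≡⟨ cong (λ e → e · 1# *ᴿ P) (nCk+nC[k+1]≡[n+1]C[k+1] n k) ⟨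
    (n C k + n C suc k) · 1# *ᴿ P
      ≈⟨ trans (*-congʳ (×-homo-+ 1# (n C k) (n C suc k))) (distribʳ P _ _) ⟩
    (n C k) · 1# *ᴿ P +ᴿ (n C suc k) · 1# *ᴿ P
      ≈⟨ +-congʳ (solve 4 (λ a x X Y → a :* (x :* X :* Y) := x :* (a :* (X :* Y))) refl
                   ((n C k) · 1#) x (x ^ k) (y ^ (n ∸ k))) ⟩
    x *ᴿ term x y n k +ᴿ term⁺ x y n (suc k) ∎
    where
    P : Carrier
    P = x ^ suc k *ᴿ y ^ (n ∸ k)

  term⁺-top : ∀ x y n → term⁺ x y n (suc n) ≈ 0#
  term⁺-top x y n = trans (*-congʳ (reflexive (cong (_· 1#) (k>n⇒nCk≡0 (n<1+n n))))) (zeroˡ _)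

  term⁺-below : ∀ x y n m → m ≤ n → term⁺ x y n m ≈ y *ᴿ term x y n m
  term⁺-below x y n m m≤n = begin
    (n C m) · 1# *ᴿ (x ^ m *ᴿ y ^ (suc n ∸ m))
      ≡⟨ cong (λ e → (n C m) · 1# *ᴿ (x ^ m *ᴿ y ^ e)) (+-∸-assoc 1 m≤n) ⟩
    (n C m) · 1# *ᴿ (x ^ m *ᴿ (y *ᴿ y ^ (n ∸ m)))
      ≈⟨ solve 4 (λ a X y Y → a :* (X :* (y :* Y)) := y :* (a :* (X :* Y))) refl
           ((n C m) · 1#) (x ^ m) y (y ^ (n ∸ m)) ⟩
    y *ᴿ term x y n m ∎

  Σ-term⁺ : ∀ x y n (h : ℕ → Carrier) → Σ (suc n) (λ m → term⁺ x y n m *ᴿ h m) ≈ y *ᴿ B x y n h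
  Σ-term⁺ x y n h = begin
    Σ n (λ m → term⁺ x y n m *ᴿ h m) +ᴿ term⁺ x y n (suc n) *ᴿ h (suc n)
      ≈⟨ +-congˡ (trans (*-congʳ (term⁺-top x y n)) (zeroˡ _)) ⟩
    Σ n (λ m → term⁺ x y n m *ᴿ h m) +ᴿ 0#
      ≈⟨ +-identityʳ _ ⟩
    Σ n (λ m → term⁺ x y n m *ᴿ h m)
      ≈⟨ Σ-cong≤ n (λ m m≤n → trans (*-congʳ (term⁺-below x y n m m≤n)) (*-assoc _ _ _)) ⟩
    Σ n (λ m → y *ᴿ (term x y n m *ᴿ h m))
      ≈⟨ Σ-*ˡ n y _ ⟩
    y *ᴿ B x y n h ∎

  B-pascal : ∀ x y n (h : ℕ → Carrier) → B x y (suc n) h ≈ y *ᴿ B x y n h +ᴿ x *ᴿ B x y n (h ∘ suc)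
  B-pascal x y n h = begin
    B x y (suc n) h
      ≈⟨ Σ-head n _ ⟩
    q 0 +ᴿ Σ n (λ k → term x y (suc n) (suc k) *ᴿ h (suc k))
      ≈⟨ +-congˡ (Σ-cong n split) ⟩
    q 0 +ᴿ Σ n (λ k → x *ᴿ (term x y n k *ᴿ h (suc k)) +ᴿ q (suc k))
      ≈⟨ +-congˡ (trans (Σ-+ n _ _) (+-congʳ (Σ-*ˡ n x _))) ⟩
    q 0 +ᴿ (x *ᴿ B x y n (h ∘ suc) +ᴿ Σ n (q ∘ suc))
      ≈⟨ solve 3 (λ a b d → a :+ (b :+ d) := (a :+ d) :+ b) refl (q 0) (x *ᴿ B x y n (h ∘ suc)) (Σ n (q ∘ suc)) ⟩
    (q 0 +ᴿ Σ n (q ∘ suc)) +ᴿ x *ᴿ B x y n (h ∘ suc)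
      ≈⟨ +-congʳ (trans (sym (Σ-head n q)) (Σ-term⁺ x y n h)) ⟩
    y *ᴿ B x y n h +ᴿ x *ᴿ B x y n (h ∘ suc) ∎
    where
    q : ℕ → Carrier
    q m = term⁺ x y n m *ᴿ h m
    split : ∀ k → term x y (suc n) (suc k) *ᴿ h (suc k) ≈ x *ᴿ (term x y n k *ᴿ h (suc k)) +ᴿ q (suc k)
    split k = trans (*-congʳ (term-pascal x y n k))
                    (trans (distribʳ _ _ _) (+-congʳ (*-assoc _ _ _)))

module ThirdOrderRecurrence {c ℓ} (R : CommutativeRing c ℓ) (r s t : CommutativeRing.Carrier R) where
  open CommutativeRing R renaming (_+_ to _+ᴿ_; _*_ to _*ᴿ_) hiding (zero)
  open RawSemiringDefinitions (Semiring.rawSemiring semiring) using (_^_) renaming (_×_ to _·_)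
  open SetoidReasoning setoid
  open NaturalSolver commutativeSemiring using (solve; _:+_; _:*_; _:=_)
  open FiniteSums R
  open BinomialTransform R

  Recurrent : (ℕ → Carrier) → Set ℓ
  Recurrent f = ∀ k → f (suc (suc (suc k))) ≈ r *ᴿ f (suc (suc k)) +ᴿ s *ᴿ f (suc k) +ᴿ t *ᴿ f k

  shift : (ℕ → Carrier) → ℕ → Carrier
  shift f k = f (suc k)

  shift-recurrent : ∀ {f} → Recurrent f → Recurrent (shift f)
  shift-recurrent rec k = rec (suc k)

  -- ((r E² + s E)^l f)(0) = Σ_{m ≤ l} C(l,m) r^m s^(l-m) f(l+m)
  inner : ℕ → (ℕ → Carrier) → Carrier
  inner l f = B r s l (λ m → f (l + m))

  -- ((t + (r E² + s E))ⁿ f)(0), expanded binomially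
  expansion : ℕ → (ℕ → Carrier) → Carrier
  expansion n f = B 1# t n (λ l → inner l f)

  inner-suc : ∀ l f → inner (suc l) f ≈ s *ᴿ inner l (shift f) +ᴿ r *ᴿ inner l (shift (shift f))
  inner-suc l f = trans (B-pascal r s l _)
    (+-congˡ (*-congˡ (B-cong r s l (λ m → reflexive (cong (f ∘ suc) (+-suc l m))))))

  -- the expansion obeys the recurrence in n with the roles of t, s, r as in E³ = t + s E + r E²
  expansion-suc : ∀ n f → expansion (suc n) f ≈
    t *ᴿ expansion n f +ᴿ (s *ᴿ expansion n (shift f) +ᴿ r *ᴿ expansion n (shift (shift f)))
  expansion-suc n f = begin
    expansion (suc n) f
      ≈⟨ B-pascal 1# t n _ ⟩
    t *ᴿ expansion n f +ᴿ 1# *ᴿ B 1# t n (λ l → inner (suc l) f)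
      ≈⟨ +-congˡ (trans (*-identityˡ _) (B-cong 1# t n (λ l → inner-suc l f))) ⟩
    t *ᴿ expansion n f +ᴿ B 1# t n (λ l → s *ᴿ inner l (shift f) +ᴿ r *ᴿ inner l (shift (shift f)))
      ≈⟨ +-congˡ (B-linear 1# t n s r _ _) ⟩
    t *ᴿ expansion n f +ᴿ (s *ᴿ expansion n (shift f) +ᴿ r *ᴿ expansion n (shift (shift f))) ∎

  -- f(3n) = ((E³)ⁿ f)(0) equals the expansion
  recurrent⇒expansion : ∀ {f} → Recurrent f → ∀ n → f (3 * n) ≈ expansion n f
  recurrent⇒expansion {f} rec zero = sym (trans (B-zero 1# t (λ l → inner l f)) (B-zero r s f))
  recurrent⇒expansion {f} rec (suc n) = begin
    f (3 * suc n)
      ≡⟨ cong f (*-suc 3 n) ⟩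
    f (3 + 3 * n)
      ≈⟨ rec (3 * n) ⟩
    r *ᴿ f (2 + 3 * n) +ᴿ s *ᴿ f (1 + 3 * n) +ᴿ t *ᴿ f (3 * n)
      ≈⟨ +-cong (+-cong (*-congˡ (recurrent⇒expansion (shift-recurrent (shift-recurrent rec)) n))
                        (*-congˡ (recurrent⇒expansion (shift-recurrent rec) n)))
                (*-congˡ (recurrent⇒expansion rec n)) ⟩
    r *ᴿ E₂ +ᴿ s *ᴿ E₁ +ᴿ t *ᴿ E₀
      ≈⟨ solve 3 (λ a b d → (a :+ b) :+ d := d :+ (b :+ a)) refl (r *ᴿ E₂) (s *ᴿ E₁) (t *ᴿ E₀) ⟩
    t *ᴿ E₀ +ᴿ (s *ᴿ E₁ +ᴿ r *ᴿ E₂)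
      ≈⟨ expansion-suc n f ⟨
    expansion (suc n) f ∎
    where
    E₀ E₁ E₂ : Carrier
    E₀ = expansion n f
    E₁ = expansion n (shift f)
    E₂ = expansion n (shift (shift f))

  coefficient : ℕ → ℕ → ℕ → Carrier
  coefficient n l m = (((n C l) · 1#) *ᴿ ((l C m) · 1#)) *ᴿ ((r ^ m) *ᴿ (s ^ (l ∸ m)) *ᴿ (t ^ (n ∸ l)))

  1^n≈1 : ∀ n → 1# ^ n ≈ 1#
  1^n≈1 zero    = refl
  1^n≈1 (suc n) = trans (*-identityˡ _) (1^n≈1 n)

  coefficient-factorises : ∀ n l m → coefficient n l m ≈ term 1# t n l *ᴿ term r s l m
  coefficient-factorises n l m = begin
    coefficient n l m
      ≈⟨ solve 5 (λ a b x y z → (a :* b) :* (x :* y :* z) := (a :* z) :* (b :* (x :* y))) refl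
           ((n C l) · 1#) ((l C m) · 1#) (r ^ m) (s ^ (l ∸ m)) (t ^ (n ∸ l)) ⟩
    ((n C l) · 1# *ᴿ t ^ (n ∸ l)) *ᴿ term r s l m
      ≈⟨ *-congʳ (*-congˡ (sym (trans (*-congʳ (1^n≈1 l)) (*-identityˡ _)))) ⟩
    term 1# t n l *ᴿ term r s l m ∎

  expansion≈coefficientSum : ∀ n f →
    expansion n f ≈ Σ n (λ l → Σ l (λ m → coefficient n l m *ᴿ f (l + m)))
  expansion≈coefficientSum n f = Σ-cong n (λ l → begin
    term 1# t n l *ᴿ inner l f
      ≈⟨ Σ-*ˡ l _ _ ⟨
    Σ l (λ m → term 1# t n l *ᴿ (term r s l m *ᴿ f (l + m)))
      ≈⟨ Σ-cong l (λ m → trans (sym (*-assoc _ _ _)) (*-congʳ (sym (coefficient-factorises n l m)))) ⟩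
    Σ l (λ m → coefficient n l m *ᴿ f (l + m)) ∎)

  tripling : ∀ {f} → Recurrent f → ∀ n →
    f (3 * n) ≈ Σ n (λ l → Σ l (λ m → coefficient n l m *ᴿ f (l + m)))
  tripling {f} rec n = trans (recurrent⇒expansion rec n) (expansion≈coefficientSum n f)

module QuaternionTripling {c ℓ} (R : CommutativeRing c ℓ) (r s t : CommutativeRing.Carrier R) (a b c : ℤ) where
  open CommutativeRing R renaming (_+_ to _+ᴿ_; _*_ to _*ᴿ_) hiding (zero)
  open SetoidReasoning setoid
  open Quat R
  open Sequence r s t a b c
  open FiniteSums R
  open ThirdOrderRecurrence R r s t

  ΣQ-coordinate : (π : Quaternion → Carrier) → (∀ p q → π (p +Q q) ≈ π p +ᴿ π q) →
    ∀ n (F : ℕ → Quaternion) → π (ΣQ n F) ≈ Σ n (π ∘ F)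
  ΣQ-coordinate π π-+ zero    F = refl
  ΣQ-coordinate π π-+ (suc n) F = trans (π-+ (ΣQ n F) (F (suc n))) (+-congʳ (ΣQ-coordinate π π-+ n F))

  V-recurrent : Recurrent V
  V-recurrent k = refl

  coordinate : ∀ n (π : Quaternion → Carrier) →
    (∀ p q → π (p +Q q) ≈ π p +ᴿ π q) → (∀ x q → π (x • q) ≈ x *ᴿ π q) → Recurrent (π ∘ QV) →
    π (QV (3 * n)) ≈ π (ΣQ n (λ l → ΣQ l (λ m → coeff n l m • QV (l + m))))
  coordinate n π π-+ π-• rec = begin
    π (QV (3 * n))
      ≈⟨ tripling rec n ⟩
    Σ n (λ l → Σ l (λ m → coeff n l m *ᴿ π (QV (l + m))))
      ≈⟨ Σ-cong n (λ l → Σ-cong l (λ m → sym (π-• (coeff n l m) (QV (l + m))))) ⟩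
    Σ n (λ l → Σ l (λ m → π (coeff n l m • QV (l + m))))
      ≈⟨ Σ-cong n (λ l → ΣQ-coordinate π π-+ l _) ⟨
    Σ n (λ l → π (ΣQ l (λ m → coeff n l m • QV (l + m))))
      ≈⟨ ΣQ-coordinate π π-+ n _ ⟨
    π (ΣQ n (λ l → ΣQ l (λ m → coeff n l m • QV (l + m)))) ∎

mainTheorem7 : ∀ {c ℓ : Level} (R : CommutativeRing c ℓ) (r s t : CommutativeRing.Carrier R) (a b c : ℤ) (n : ℕ) →
    let open Quat R in
    let open Sequence r s t a b c in
    QV (3 * n) ≈Q ΣQ n (λ l → ΣQ l (λ m → coeff n l m • QV (l + m)))
mainTheorem7 R r s t a b c n =
    coordinate n Q.re  (λ _ _ → refl) (λ _ _ → refl) V-recurrent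
  , coordinate n Q.imi (λ _ _ → refl) (λ _ _ → refl) (shift-recurrent V-recurrent)
  , coordinate n Q.imj (λ _ _ → refl) (λ _ _ → refl) (shift-recurrent (shift-recurrent V-recurrent))
  , coordinate n Q.imk (λ _ _ → refl) (λ _ _ → refl) (shift-recurrent (shift-recurrent (shift-recurrent V-recurrent)))
  where
  module Q = Quat R
  open CommutativeRing R using (refl)
  open ThirdOrderRecurrence R r s t using (shift-recurrent)
  open QuaternionTripling R r s t a b c using (V-recurrent; coordinate)
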